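{- A matroid $M$ is almost $3$-connected if and only if it is connected and for every $2$-separation $(A,B)$ of $M$ we have $\mathrm{rk}(A)=1$ or $\mathrm{rk}(B)=1$.
   Context: Standing assumption: $M$ has no loops. A $k$-separation of a matroid with ground set $E$ is a partition $(A,B)$ of $E$ with $|A|,|B|\ge k$ and $\mathrm{rk}(A)+\mathrm{rk}(B)\le\mathrm{rk}(E)+k-1$. A matroid is connected if it has no $1$-separation, and $3$-connected if it has no $1$- or $2$-separation. The simplification $\mathrm{si}(M)$ is obtained by removing loops and deleting elements until no two elements are parallel (form a $2$-element circuit); $M$ is almost $3$-connected if $\mathrm{si}(M)$ is $3$-connected. -}

module Defs where

open import Data.Nat using (ℕ; _+_; _∸_; _≤_)
open import Data.Fin using (Fin)
open import Data.Fin.Subset using (Subset; ⁅_⁆; _∈_; _⊆_; _∩_; _∪_; ∣_∣; ⊤; ⊥)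
open import Data.Product using (Σ; _×_; ∃)
open import Data.Sum using (_⊎_)
open import Relation.Binary.PropositionalEquality using (_≡_; _≢_)
open import Relation.Nullary using (¬_)

record Matroid : Set where
  field
    n          : ℕ
    rk         : Subset n → ℕ
    rk-bound   : ∀ X → rk X ≤ ∣ X ∣
    rk-mono    : ∀ {X Y} → X ⊆ Y → rk X ≤ rk Y
    rk-submod  : ∀ X Y → rk (X ∪ Y) + rk (X ∩ Y) ≤ rk X + rk Y

open Matroid public

Loopless : Matroid → Set
Loopless M = ∀ (e : Fin (n M)) → rk M ⁅ e ⁆ ≡ 1

-- e and f are parallel: {e,f} is a 2-element circuit.
Parallel : (M : Matroid) → Fin (n M) → Fin (n M) → Set
Parallel M e f =
  e ≢ f × rk M ⁅ e ⁆ ≡ 1 × rk M ⁅ f ⁆ ≡ 1 × rk M (⁅ e ⁆ ∪ ⁅ f ⁆) ≡ 1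

-- A k-separation of the restriction M|S (ground set S, rank = rk M on subsets of S):
-- a partition (A,B) of S with |A|,|B| ≥ k and rk A + rk B ≤ rk S + k - 1.
IsSeparationOn : (M : Matroid) → Subset (n M) → ℕ → Subset (n M) → Subset (n M) → Set
IsSeparationOn M S k A B =
  (A ∪ B ≡ S) × (A ∩ B ≡ ⊥) × (k ≤ ∣ A ∣) × (k ≤ ∣ B ∣)
  × (rk M A + rk M B ≤ rk M S + (k ∸ 1))

IsSeparation : (M : Matroid) → ℕ → Subset (n M) → Subset (n M) → Set
IsSeparation M = IsSeparationOn M ⊤

ConnectedOn : (M : Matroid) → Subset (n M) → Set
ConnectedOn M S = ∀ A B → ¬ IsSeparationOn M S 1 A B

ThreeConnectedOn : (M : Matroid) → Subset (n M) → Set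
ThreeConnectedOn M S = ∀ A B → ¬ IsSeparationOn M S 1 A B × ¬ IsSeparationOn M S 2 A B

Connected : Matroid → Set
Connected M = ConnectedOn M ⊤

-- S is the ground set of a simplification of M: the result of removing loops
-- and deleting elements until no two are parallel.
IsSimplification : (M : Matroid) → Subset (n M) → Set
IsSimplification M S =
  (∀ e → e ∈ S → rk M ⁅ e ⁆ ≡ 1)
  × (∀ e f → e ∈ S → f ∈ S → ¬ Parallel M e f)
  × (∀ e → ¬ (e ∈ S) → rk M ⁅ e ⁆ ≡ 0 ⊎ Σ (Fin (n M)) (λ f → f ∈ S × Parallel M e f))

AlmostThreeConnected : Matroid → Set
AlmostThreeConnected M = Σ (Subset (n M)) (λ S → IsSimplification M S × ThreeConnectedOn M S)

-- Fix a simplification S and send every element e to rep e, namely e itself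
-- or a parallel element of S; then e and rep e span each other.  A
-- k-separation (X, Y) of M|S lifts to the k-separation (rep⁻¹ X, rep⁻¹ Y) of M,
-- whose sides have no larger rank.  Hence a 1-separation of si(M) contradicts
-- connectivity, and a 2-separation lifts to one with a side of rank 1, which
-- would make the two elements of S on that side parallel.  Conversely, let
-- (A, B) be a k-separation of M (k ≤ 2) with both ranks at least k.  The
-- elements of S spanned by A form a set X of the rank of A, the others form a
-- nonempty Y ⊆ B, and (X, Y) is a j-separation of si(M) for j = min(|Y|, k).

module Submission where

open import Defs
open import Level using (Level)
open import Data.Nat using (ℕ; suc; _+_; _≤_; _<_; _≟_; _≤?_; z≤n; s≤s)
open import Data.Nat.Properties
open import Data.Fin using (Fin; toℕ) renaming (_≟_ to _≟ᶠ_; _<_ to _<ᶠ_)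
open import Data.Fin.Properties using (any?) renaming (_<?_ to _<ᶠ?_; <-cmp to <ᶠ-cmp)
open import Data.Fin.Subset
  using (Subset; ⁅_⁆; _∈_; _∉_; _⊆_; _∩_; _∪_; ∁; ∣_∣; ⊤; ⊥; ⋃; Nonempty; Empty)
open import Data.Fin.Subset.Properties
open import Data.List using (List)
import Data.List as List
open import Data.List.Membership.Propositional using () renaming (_∈_ to _∈ˡ_)
open import Data.List.Membership.Propositional.Properties using (∈-tabulate⁺)
open import Data.List.Relation.Unary.All using (All; []; _∷_)
open import Data.List.Relation.Unary.All.Properties using (tabulate⁺)
open import Data.List.Relation.Unary.Any using (here; there)
open import Data.Vec using (tabulate)
open import Data.Vec.Properties using (lookup∘tabulate; []=⇒lookup; lookup⇒[]=)
open import Data.Product using (Σ; _×_; _,_; proj₁; proj₂)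
open import Data.Sum using (_⊎_; inj₁; inj₂; [_,_])
open import Data.Empty using (⊥-elim)
open import Function using (_∘_)
open import Function.Bundles using (_⇔_; mk⇔)
open import Relation.Binary using (tri<; tri≈; tri>)
open import Relation.Binary.PropositionalEquality
  using (_≡_; _≢_; refl; sym; trans; subst; cong; module ≡-Reasoning)
open import Relation.Nullary using (¬_; Dec; yes; no; does; contradiction)
open import Relation.Nullary.Decidable using (dec-true; _×-dec_; ¬?)
open import Relation.Unary using (Pred; Decidable)

private
  variable
    m k : ℕ

select : {ℓ : Level} {P : Pred (Fin k) ℓ} → Decidable P → Subset k
select P? = tabulate (λ i → does (P? i))

∈-select⁺ : {ℓ : Level} {P : Pred (Fin k) ℓ} (P? : Decidable P) {x : Fin k} →
            P x → x ∈ select P?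
∈-select⁺ P? {x} px = lookup⇒[]= x _ (trans (lookup∘tabulate _ x) (dec-true (P? x) px))

∈-select⁻ : {ℓ : Level} {P : Pred (Fin k) ℓ} (P? : Decidable P) {x : Fin k} →
            x ∈ select P? → P x
∈-select⁻ P? {x} x∈ with P? x | trans (sym (lookup∘tabulate (λ i → does (P? i)) x)) ([]=⇒lookup x∈)
... | yes px | _ = px
... | no _   | ()

⁅x⁆⊆p : {x : Fin k} {p : Subset k} → x ∈ p → ⁅ x ⁆ ⊆ p
⁅x⁆⊆p x∈p y∈⁅x⁆ = subst (_∈ _) (sym (x∈⁅y⁆⇒x≡y _ y∈⁅x⁆)) x∈p

∪-lub : {p q r : Subset k} → p ⊆ r → q ⊆ r → p ∪ q ⊆ r
∪-lub {p = p} {q = q} p⊆r q⊆r x∈p∪q = [ p⊆r , q⊆r ] (x∈p∪q⁻ p q x∈p∪q)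

∪-mono : {p p′ q q′ : Subset k} → p ⊆ p′ → q ⊆ q′ → p ∪ q ⊆ p′ ∪ q′
∪-mono {p′ = p′} {q′ = q′} p⊆p′ q⊆q′ =
  ∪-lub (p⊆p∪q q′ ∘ p⊆p′) (q⊆p∪q p′ q′ ∘ q⊆q′)

∈-⋃⁺ : {x : Fin k} {p : Subset k} {ps : List (Subset k)} → p ∈ˡ ps → x ∈ p → x ∈ ⋃ ps
∈-⋃⁺ {ps = q List.∷ qs} (here refl) x∈p = p⊆p∪q (⋃ qs) x∈p
∈-⋃⁺ {ps = q List.∷ qs} (there p∈) x∈p = q⊆p∪q q (⋃ qs) (∈-⋃⁺ p∈ x∈p)

Empty⇒∣p∣≡0 : {p : Subset k} → Empty p → ∣ p ∣ ≡ 0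
Empty⇒∣p∣≡0 {k} ¬ne = trans (cong ∣_∣ (Empty-unique ¬ne)) (∣⊥∣≡0 k)

1≤∣p∣⇒Nonempty : {p : Subset k} → 1 ≤ ∣ p ∣ → Nonempty p
1≤∣p∣⇒Nonempty {p = p} 1≤∣p∣ with nonempty? p
... | yes ne = ne
... | no ¬ne = contradiction (subst (1 ≤_) (Empty⇒∣p∣≡0 ¬ne) 1≤∣p∣) (λ ())

Nonempty⇒∣p∣≡suc : {p : Subset k} → Nonempty p → Σ ℕ λ i → ∣ p ∣ ≡ suc i
Nonempty⇒∣p∣≡suc {p = p} (x , x∈p)
  with ∣ p ∣ | subst (_≤ ∣ p ∣) (∣⁅x⁆∣≡1 x) (p⊆q⇒∣p∣≤∣q∣ (⁅x⁆⊆p x∈p))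
... | suc i | _ = i , refl

∩-∁-partition : (s c : Subset k) → ((s ∩ c) ∪ (s ∩ ∁ c) ≡ s) × ((s ∩ c) ∩ (s ∩ ∁ c) ≡ ⊥)
∩-∁-partition s c = covered , ⊆-antisym disjoint ⊥⊆
  where
  open ≡-Reasoning
  covered : (s ∩ c) ∪ (s ∩ ∁ c) ≡ s
  covered = begin
    (s ∩ c) ∪ (s ∩ ∁ c) ≡⟨ sym (∩-distribˡ-∪ s c (∁ c)) ⟩
    s ∩ (c ∪ ∁ c)       ≡⟨ cong (s ∩_) (p∪∁p≡⊤ c) ⟩
    s ∩ ⊤               ≡⟨ ∩-identityʳ s ⟩
    s                   ∎
  disjoint : (s ∩ c) ∩ (s ∩ ∁ c) ⊆ ⊥
  disjoint x∈ with x∈p∩q⁻ (s ∩ c) (s ∩ ∁ c) x∈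
  ... | x∈s∩c , x∈s∩∁c =
    contradiction (proj₂ (x∈p∩q⁻ s c x∈s∩c)) (x∈∁p⇒x∉p (proj₂ (x∈p∩q⁻ s (∁ c) x∈s∩∁c)))

preimage : (Fin m → Fin k) → Subset k → Subset m
preimage f x = select (λ e → f e ∈? x)

preimage-partition : {s x y : Subset k} (f : Fin m → Fin k) → (∀ e → f e ∈ s) →
                     x ∪ y ≡ s → x ∩ y ≡ ⊥ →
                     (preimage f x ∪ preimage f y ≡ ⊤) × (preimage f x ∩ preimage f y ≡ ⊥)
preimage-partition {s = s} {x} {y} f f∈s x∪y≡s x∩y≡⊥ = ⊆-antisym ⊆⊤ covered , ⊆-antisym disjoint ⊥⊆
  where
  covered : ⊤ ⊆ preimage f x ∪ preimage f y
  covered {e} _ = [ p⊆p∪q (preimage f y) ∘ ∈-select⁺ (λ e → f e ∈? x)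
                   , q⊆p∪q (preimage f x) (preimage f y) ∘ ∈-select⁺ (λ e → f e ∈? y)
                   ] (x∈p∪q⁻ x y (subst (f e ∈_) (sym x∪y≡s) (f∈s e)))
  disjoint : preimage f x ∩ preimage f y ⊆ ⊥
  disjoint {e} e∈ with x∈p∩q⁻ (preimage f x) (preimage f y) e∈
  ... | e∈fx , e∈fy = ⊥-elim (∉⊥ (subst (f e ∈_) x∩y≡⊥
                        (x∈p∩q⁺ (∈-select⁻ (λ e → f e ∈? x) e∈fx , ∈-select⁻ (λ e → f e ∈? y) e∈fy))))

module _ (M : Matroid) where

  private
    E : ℕ
    E = n M
    r : Subset E → ℕ
    r = rk M

  Covers : Subset E → Set
  Covers S = ∀ e → e ∉ S → Σ (Fin E) λ f → f ∈ S × Parallel M e f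

  Simple : Subset E → Set
  Simple S = ∀ e f → e ∈ S → f ∈ S → ¬ Parallel M e f

  rk-submod-⊆ : {U V X Y : Subset E} → U ⊆ X ∪ Y → V ⊆ X ∩ Y → r U + r V ≤ r X + r Y
  rk-submod-⊆ {X = X} {Y} U⊆ V⊆ =
    ≤-trans (+-mono-≤ (rk-mono M U⊆) (rk-mono M V⊆)) (rk-submod M X Y)

  -- Spans Z P says that P lies in the closure of Z.
  Spans : Subset E → Subset E → Set
  Spans Z P = r (Z ∪ P) ≤ r Z

  spans? : ∀ Z P → Dec (Spans Z P)
  spans? Z P = r (Z ∪ P) ≤? r Z

  spans⇒rk≤ : {Z P : Subset E} → Spans Z P → r P ≤ r Z
  spans⇒rk≤ {Z} {P} Z↠P = ≤-trans (rk-mono M (q⊆p∪q Z P)) Z↠P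

  ⊆⇒spans : {Z P : Subset E} → P ⊆ Z → Spans Z P
  ⊆⇒spans P⊆Z = rk-mono M (∪-lub ⊆-refl P⊆Z)

  spans-⊆ : {Z P Q : Subset E} → P ⊆ Q → Spans Z Q → Spans Z P
  spans-⊆ P⊆Q Z↠Q = ≤-trans (rk-mono M (∪-mono ⊆-refl P⊆Q)) Z↠Q

  spans-monoˡ : {Y Z P : Subset E} → Y ⊆ Z → Spans Y P → Spans Z P
  spans-monoˡ {Y} {Z} {P} Y⊆Z Y↠P = +-cancelʳ-≤ (r Y) _ _ (≤-trans
    (rk-submod-⊆ {X = Z} {Y ∪ P} (∪-mono ⊆-refl (q⊆p∪q Y P))
                                 (λ x∈Y → x∈p∩q⁺ (Y⊆Z x∈Y , p⊆p∪q P x∈Y)))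
    (+-monoʳ-≤ (r Z) Y↠P))

  spans-∪ : {Z P Q : Subset E} → Spans Z P → Spans Z Q → Spans Z (P ∪ Q)
  spans-∪ {Z} {P} {Q} Z↠P Z↠Q = +-cancelʳ-≤ (r Z) _ _ (≤-trans
    (rk-submod-⊆ {X = Z ∪ P} {Z ∪ Q}
      (∪-lub (p⊆p∪q (Z ∪ Q) ∘ p⊆p∪q P) (∪-mono (q⊆p∪q Z P) (q⊆p∪q Z Q)))
      (λ x∈Z → x∈p∩q⁺ (p⊆p∪q P x∈Z , p⊆p∪q Q x∈Z)))
    (+-mono-≤ Z↠P Z↠Q))

  spans-⋃ : {Z : Subset E} (Ps : List (Subset E)) → All (Spans Z) Ps → Spans Z (⋃ Ps)
  spans-⋃ List.[]       []         = ⊆⇒spans ⊥⊆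
  spans-⋃ (P List.∷ Ps) (Z↠P ∷ Z↠Ps) = spans-∪ Z↠P (spans-⋃ Ps Z↠Ps)

  spans-pointwise : {Z P : Subset E} → (∀ {e} → e ∈ P → Spans Z ⁅ e ⁆) → Spans Z P
  spans-pointwise {Z} {P} Z↠e =
    spans-⊆ (λ {x} x∈P → ∈-⋃⁺ (∈-tabulate⁺ x) (x∈p∩q⁺ (x∈P , x∈⁅x⁆ x)))
            (spans-⋃ (List.tabulate piece) (tabulate⁺ spans-piece))
    where
    piece : Fin E → Subset E
    piece e = P ∩ ⁅ e ⁆
    spans-piece : ∀ e → Spans Z (piece e)
    spans-piece e with e ∈? P
    ... | yes e∈P = spans-⊆ (p∩q⊆q P ⁅ e ⁆) (Z↠e e∈P)
    ... | no  e∉P = ⊆⇒spans λ x∈ → contradiction (⁅x⁆⊆p (proj₁ (x∈p∩q⁻ P _ x∈)) (x∈⁅x⁆ _)) (x∉P x∈)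
      where
      x∉P : ∀ {x} → x ∈ piece e → x ∉ P
      x∉P x∈ x∈P = e∉P (subst (_∈ P) (x∈⁅y⁆⇒x≡y e (proj₂ (x∈p∩q⁻ P _ x∈))) x∈P)

  parallel⇒spans : {e f : Fin E} → Parallel M e f → Spans ⁅ f ⁆ ⁅ e ⁆
  parallel⇒spans {e} {f} (_ , _ , rk-f , rk-ef) = begin
    r (⁅ f ⁆ ∪ ⁅ e ⁆) ≡⟨ cong r (∪-comm ⁅ f ⁆ ⁅ e ⁆) ⟩
    r (⁅ e ⁆ ∪ ⁅ f ⁆) ≡⟨ trans rk-ef (sym rk-f) ⟩
    r ⁅ f ⁆           ∎
    where open ≤-Reasoning

  parallel-sym : {e f : Fin E} → Parallel M e f → Parallel M f e
  parallel-sym {e} {f} (e≢f , rk-e , rk-f , rk-ef) =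
    e≢f ∘ sym , rk-f , rk-e , trans (cong r (∪-comm ⁅ f ⁆ ⁅ e ⁆)) rk-ef

  parallel-trans : {e f g : Fin E} → e ≢ g → Parallel M e f → Parallel M f g → Parallel M e g
  parallel-trans {e} {f} {g} e≢g e∥f@(_ , rk-e , rk-f , _) f∥g@(_ , _ , rk-g , _) =
    e≢g , rk-e , rk-g , ≤-antisym rk-eg≤1 (subst (_≤ r (⁅ e ⁆ ∪ ⁅ g ⁆)) rk-e (rk-mono M (p⊆p∪q ⁅ g ⁆)))
    where
    rk-eg≤1 : r (⁅ e ⁆ ∪ ⁅ g ⁆) ≤ 1
    rk-eg≤1 = subst (r (⁅ e ⁆ ∪ ⁅ g ⁆) ≤_) rk-f
                (spans⇒rk≤ (spans-∪ (parallel⇒spans e∥f) (parallel⇒spans (parallel-sym f∥g))))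

  parallel? : ∀ e f → Dec (Parallel M e f)
  parallel? e f =
    ¬? (e ≟ᶠ f) ×-dec r ⁅ e ⁆ ≟ 1 ×-dec r ⁅ f ⁆ ≟ 1 ×-dec r (⁅ e ⁆ ∪ ⁅ f ⁆) ≟ 1

  HasEarlierParallel : Fin E → Set
  HasEarlierParallel e = Σ (Fin E) λ f → f <ᶠ e × Parallel M e f

  hasEarlierParallel? : Decidable HasEarlierParallel
  hasEarlierParallel? e = any? (λ f → f <ᶠ? e ×-dec parallel? e f)

  earliest : Subset E
  earliest = select (¬? ∘ hasEarlierParallel?)

  ∉earliest⇒HasEarlierParallel : ∀ {e} → e ∉ earliest → HasEarlierParallel e
  ∉earliest⇒HasEarlierParallel {e} e∉ with hasEarlierParallel? e
  ... | yes earlier  = earlier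
  ... | no  ¬earlier = contradiction (∈-select⁺ (¬? ∘ hasEarlierParallel?) ¬earlier) e∉

  earliest-simple : Simple earliest
  earliest-simple e f e∈ f∈ e∥f with <ᶠ-cmp e f
  ... | tri< e<f _ _ = ∈-select⁻ (¬? ∘ hasEarlierParallel?) f∈ (e , e<f , parallel-sym e∥f)
  ... | tri≈ _ e≡f _ = proj₁ e∥f e≡f
  ... | tri> _ _ f<e = ∈-select⁻ (¬? ∘ hasEarlierParallel?) e∈ (f , f<e , e∥f)

  -- The bound on toℕ e makes the descent along earlier parallel elements structural.
  earliest-covers-below : ∀ bound e → toℕ e < bound → e ∉ earliest →
                          Σ (Fin E) λ f → f ∈ earliest × Parallel M e f
  earliest-covers-below (suc bound) e e<bound e∉ with ∉earliest⇒HasEarlierParallel e∉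
  ... | f , f<e , e∥f with f ∈? earliest
  ...   | yes f∈ = f , f∈ , e∥f
  ...   | no  f∉ with earliest-covers-below bound f (≤-trans f<e (≤-pred e<bound)) f∉
  ...     | g , g∈ , f∥g = g , g∈ , parallel-trans (λ { refl → e∉ g∈ }) e∥f f∥g

  earliest-covers : Covers earliest
  earliest-covers e = earliest-covers-below (suc (toℕ e)) e ≤-refl

  earliest-isSimplification : Loopless M → IsSimplification M earliest
  earliest-isSimplification loopless =
    (λ e _ → loopless e) , earliest-simple , λ e e∉ → inj₂ (earliest-covers e e∉)

  simplification-covers : Loopless M → ∀ {S} → IsSimplification M S → Covers S
  simplification-covers loopless (_ , _ , deleted) e e∉S with deleted e e∉S
  ... | inj₁ e-loop = contradiction (trans (sym (loopless e)) e-loop) (λ ())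
  ... | inj₂ parallel = parallel

  rk-positive : Loopless M → ∀ {X} → 1 ≤ ∣ X ∣ → 1 ≤ r X
  rk-positive loopless {X} 1≤∣X∣ with 1≤∣p∣⇒Nonempty {p = X} 1≤∣X∣
  ... | x , x∈X = subst (_≤ r X) (loopless x) (rk-mono M (⁅x⁆⊆p x∈X))

  simple-rk≤1⇒∣∣≤1 : Loopless M → ∀ {S Z} → Simple S → Z ⊆ S → r Z ≤ 1 → ∣ Z ∣ ≤ 1
  simple-rk≤1⇒∣∣≤1 loopless {S} {Z} simple Z⊆S rkZ≤1 with nonempty? Z
  ... | no  ¬ne       = ≤-trans (≤-reflexive (Empty⇒∣p∣≡0 ¬ne)) z≤n
  ... | yes (x , x∈Z) = ≤-trans (p⊆q⇒∣p∣≤∣q∣ Z⊆⁅x⁆) (≤-reflexive (∣⁅x⁆∣≡1 x))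
    where
    Z⊆⁅x⁆ : Z ⊆ ⁅ x ⁆
    Z⊆⁅x⁆ {y} y∈Z with y ≟ᶠ x
    ... | yes refl = x∈⁅x⁆ x
    ... | no  y≢x  = contradiction y∥x (simple y x (Z⊆S y∈Z) (Z⊆S x∈Z))
      where
      y∥x : Parallel M y x
      y∥x = y≢x , loopless y , loopless x ,
            ≤-antisym (≤-trans (rk-mono M (∪-lub (⁅x⁆⊆p y∈Z) (⁅x⁆⊆p x∈Z))) rkZ≤1)
                      (subst (_≤ r (⁅ y ⁆ ∪ ⁅ x ⁆)) (loopless y) (rk-mono M (p⊆p∪q ⁅ x ⁆)))

  HasSeparationOfOrder≤ : Subset E → ℕ → Set
  HasSeparationOfOrder≤ S k =
    Σ ℕ λ i → suc i ≤ k × Σ (Subset E) λ X → Σ (Subset E) λ Y → IsSeparationOn M S (suc i) X Y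

  ThreeConnectedOn⇒¬HasSeparationOfOrder≤2 : ∀ {S} → ThreeConnectedOn M S → ¬ HasSeparationOfOrder≤ S 2
  ThreeConnectedOn⇒¬HasSeparationOfOrder≤2 3conn (_ , s≤s z≤n       , X , Y , sep) = proj₁ (3conn X Y) sep
  ThreeConnectedOn⇒¬HasSeparationOfOrder≤2 3conn (_ , s≤s (s≤s z≤n) , X , Y , sep) = proj₂ (3conn X Y) sep

module Covering (M : Matroid) {S : Subset (n M)} (covers : Covers M S) where

  private
    E : ℕ
    E = n M
    r : Subset E → ℕ
    r = rk M

  rep : Fin E → Fin E
  rep e with e ∈? S
  ... | yes _   = e
  ... | no  e∉S = proj₁ (covers e e∉S)

  rep-∈ : ∀ e → rep e ∈ S
  rep-∈ e with e ∈? S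
  ... | yes e∈S = e∈S
  ... | no  e∉S = proj₁ (proj₂ (covers e e∉S))

  rep-id : ∀ {e} → e ∈ S → rep e ≡ e
  rep-id {e} e∈S with e ∈? S
  ... | yes _   = refl
  ... | no  e∉S = contradiction e∈S e∉S

  rep-spans : ∀ e → Spans M ⁅ rep e ⁆ ⁅ e ⁆ × Spans M ⁅ e ⁆ ⁅ rep e ⁆
  rep-spans e with e ∈? S
  ... | yes _   = ⊆⇒spans M ⊆-refl , ⊆⇒spans M ⊆-refl
  ... | no  e∉S = parallel⇒spans M e∥f , parallel⇒spans M (parallel-sym M e∥f)
    where
    e∥f : Parallel M e (proj₁ (covers e e∉S))
    e∥f = proj₂ (proj₂ (covers e e∉S))

  spans-via-rep : ∀ {Z e} → rep e ∈ Z → Spans M Z ⁅ e ⁆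
  spans-via-rep {e = e} rep∈Z = spans-monoˡ M (⁅x⁆⊆p rep∈Z) (proj₁ (rep-spans e))

  rk⊤≤rkS : r ⊤ ≤ r S
  rk⊤≤rkS = spans⇒rk≤ M (spans-pointwise M (λ {e} _ → spans-via-rep (rep-∈ e)))

  separation-lifts : ∀ {k X Y} → IsSeparationOn M S k X Y →
                     Σ (Subset E) λ A → Σ (Subset E) λ B → IsSeparation M k A B × X ⊆ A × Y ⊆ B
  separation-lifts {k} {X} {Y} (X∪Y≡S , X∩Y≡⊥ , k≤∣X∣ , k≤∣Y∣ , X+Y≤S) =
    preimage rep X , preimage rep Y ,
    ( proj₁ partition , proj₂ partition
    , ≤-trans k≤∣X∣ (p⊆q⇒∣p∣≤∣q∣ X⊆A) , ≤-trans k≤∣Y∣ (p⊆q⇒∣p∣≤∣q∣ Y⊆B)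
    , ≤-trans (+-mono-≤ (rk-preimage X) (rk-preimage Y)) (≤-trans X+Y≤S (+-monoˡ-≤ _ (rk-mono M ⊆⊤))) )
    , X⊆A , Y⊆B
    where
    partition : (preimage rep X ∪ preimage rep Y ≡ ⊤) × (preimage rep X ∩ preimage rep Y ≡ ⊥)
    partition = preimage-partition rep rep-∈ X∪Y≡S X∩Y≡⊥
    rk-preimage : ∀ Z → r (preimage rep Z) ≤ r Z
    rk-preimage Z = spans⇒rk≤ M (spans-pointwise M (spans-via-rep ∘ ∈-select⁻ (λ e → rep e ∈? Z)))
    ⊆preimage : ∀ {Z} → Z ⊆ S → Z ⊆ preimage rep Z
    ⊆preimage {Z} Z⊆S z∈Z = ∈-select⁺ (λ e → rep e ∈? Z) (subst (_∈ Z) (sym (rep-id (Z⊆S z∈Z))) z∈Z)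
    X⊆A : X ⊆ preimage rep X
    X⊆A = ⊆preimage (subst (X ⊆_) X∪Y≡S (p⊆p∪q Y))
    Y⊆B : Y ⊆ preimage rep Y
    Y⊆B = ⊆preimage (subst (Y ⊆_) X∪Y≡S (q⊆p∪q X Y))

  private
    module Descent {k : ℕ} {A B : Subset E} (sep : IsSeparation M (suc k) A B)
                   (k<rkA : suc k ≤ r A) (k<rkB : suc k ≤ r B) where

      A∪B≡⊤ : A ∪ B ≡ ⊤
      A∪B≡⊤ = proj₁ sep
      A+B≤⊤ : r A + r B ≤ r ⊤ + k
      A+B≤⊤ = proj₂ (proj₂ (proj₂ (proj₂ sep)))

      C X Y : Subset E
      C = select (λ e → spans? M A ⁅ e ⁆)
      X = S ∩ C
      Y = S ∩ ∁ C

      rkX≤rkA : r X ≤ r A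
      rkX≤rkA = spans⇒rk≤ M
        (spans-pointwise M (∈-select⁻ (λ e → spans? M A ⁅ e ⁆) ∘ proj₂ ∘ x∈p∩q⁻ S C))

      rkA≤rkX : r A ≤ r X
      rkA≤rkX = spans⇒rk≤ M (spans-pointwise M λ {e} e∈A →
        spans-via-rep (x∈p∩q⁺ (rep-∈ e , ∈-select⁺ (λ e → spans? M A ⁅ e ⁆)
                                           (spans-monoˡ M (⁅x⁆⊆p e∈A) (proj₂ (rep-spans e))))))

      Y⊆B : Y ⊆ B
      Y⊆B {y} y∈Y = [ (λ y∈A → contradiction (∈-select⁺ (λ e → spans? M A ⁅ e ⁆) (⊆⇒spans M (⁅x⁆⊆p y∈A)))
                                              (x∈∁p⇒x∉p (proj₂ (x∈p∩q⁻ S (∁ C) y∈Y))))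
                    , (λ y∈B → y∈B) ] (x∈p∪q⁻ A B (subst (y ∈_) (sym A∪B≡⊤) ∈⊤))

      partition : (X ∪ Y ≡ S) × (X ∩ Y ≡ ⊥)
      partition = ∩-∁-partition S C

      Y-nonempty : Nonempty Y
      Y-nonempty with nonempty? Y
      ... | yes ne = ne
      ... | no ¬ne =
        contradiction (+-cancelˡ-≤ (r A) (r B) k (≤-trans A+B≤⊤ (+-monoˡ-≤ k rk⊤≤rkA))) (<⇒≱ k<rkB)
        where
        S⊆X : S ⊆ X
        S⊆X x∈S = [ (λ x∈X → x∈X) , (λ x∈Y → contradiction (_ , x∈Y) ¬ne) ]
                    (x∈p∪q⁻ X Y (subst (_ ∈_) (sym (proj₁ partition)) x∈S))
        rk⊤≤rkA : r ⊤ ≤ r A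
        rk⊤≤rkA = ≤-trans rk⊤≤rkS (≤-trans (rk-mono M S⊆X) rkX≤rkA)

      1+rkA≤rkS : suc (r A) ≤ r S
      1+rkA≤rkS = ≤-trans (+-cancelʳ-≤ k (suc (r A)) (r ⊤)
                    (≤-trans (≤-reflexive (sym (+-suc (r A) k))) (≤-trans (+-monoʳ-≤ (r A) k<rkB) A+B≤⊤)))
                  rk⊤≤rkS

      ≤∣X∣ : ∀ {i} → i ≤ k → suc i ≤ ∣ X ∣
      ≤∣X∣ i≤k = ≤-trans (s≤s i≤k) (≤-trans k<rkA (≤-trans rkA≤rkX (rk-bound M X)))

      descended : HasSeparationOfOrder≤ M S (suc k)
      descended with Nonempty⇒∣p∣≡suc Y-nonempty
      ... | i , ∣Y∣≡1+i with i ≤? k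
      ...   | yes i≤k = i , s≤s i≤k , X , Y , proj₁ partition , proj₂ partition ,
                        ≤∣X∣ i≤k , ≤-reflexive (sym ∣Y∣≡1+i) ,
                        ≤-trans (+-mono-≤ rkX≤rkA (≤-trans (rk-bound M Y) (≤-reflexive ∣Y∣≡1+i)))
                                (≤-trans (≤-reflexive (+-suc (r A) i)) (+-monoˡ-≤ i 1+rkA≤rkS))
      ...   | no  i≰k = k , ≤-refl , X , Y , proj₁ partition , proj₂ partition ,
                        ≤∣X∣ ≤-refl ,
                        ≤-trans (m≤n⇒m≤1+n (≰⇒> i≰k)) (≤-reflexive (sym ∣Y∣≡1+i)) ,
                        ≤-trans (+-mono-≤ rkX≤rkA (rk-mono M Y⊆B)) (≤-trans A+B≤⊤ (+-monoˡ-≤ k rk⊤≤rkS))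

  separation-descends : ∀ {k A B} → IsSeparation M (suc k) A B → suc k ≤ r A → suc k ≤ r B →
                        HasSeparationOfOrder≤ M S (suc k)
  separation-descends = Descent.descended

TwoSeparationsHaveRankOneSide : Matroid → Set
TwoSeparationsHaveRankOneSide M = ∀ A B → IsSeparation M 2 A B → rk M A ≡ 1 ⊎ rk M B ≡ 1

module _ (M : Matroid) (loopless : Loopless M) {S : Subset (n M)} (simp : IsSimplification M S) where

  open Covering M (simplification-covers M loopless simp)

  private
    ThreeConnectedOn⇒¬IsSeparation : ThreeConnectedOn M S → ∀ {k A B} → k ≤ 1 →
                                     suc k ≤ rk M A → suc k ≤ rk M B → ¬ IsSeparation M (suc k) A B
    ThreeConnectedOn⇒¬IsSeparation 3conn k≤1 k<rkA k<rkB sep with separation-descends sep k<rkA k<rkB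
    ... | i , i<k , X , Y , sepS =
      ThreeConnectedOn⇒¬HasSeparationOfOrder≤2 M 3conn (i , ≤-trans i<k (s≤s k≤1) , X , Y , sepS)

    rk≢1⇒2≤rk : ∀ {Z} → 1 ≤ ∣ Z ∣ → rk M Z ≢ 1 → 2 ≤ rk M Z
    rk≢1⇒2≤rk 1≤∣Z∣ rkZ≢1 = ≤∧≢⇒< (rk-positive M loopless 1≤∣Z∣) (rkZ≢1 ∘ sym)

  ThreeConnectedOn⇒connected : ThreeConnectedOn M S → Connected M
  ThreeConnectedOn⇒connected 3conn A B sep@(_ , _ , 1≤∣A∣ , 1≤∣B∣ , _) =
    ThreeConnectedOn⇒¬IsSeparation 3conn z≤n
      (rk-positive M loopless 1≤∣A∣) (rk-positive M loopless 1≤∣B∣) sep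

  ThreeConnectedOn⇒rank-one-side : ThreeConnectedOn M S → TwoSeparationsHaveRankOneSide M
  ThreeConnectedOn⇒rank-one-side 3conn A B sep@(_ , _ , 2≤∣A∣ , 2≤∣B∣ , _) with rk M A ≟ 1 | rk M B ≟ 1
  ... | yes rkA≡1 | _         = inj₁ rkA≡1
  ... | no  _     | yes rkB≡1 = inj₂ rkB≡1
  ... | no  rkA≢1 | no  rkB≢1 = ⊥-elim (ThreeConnectedOn⇒¬IsSeparation 3conn (s≤s z≤n)
                                  (rk≢1⇒2≤rk (≤-trans (n≤1+n 1) 2≤∣A∣) rkA≢1)
                                  (rk≢1⇒2≤rk (≤-trans (n≤1+n 1) 2≤∣B∣) rkB≢1) sep)

  connected⇒ThreeConnectedOn : Connected M → TwoSeparationsHaveRankOneSide M → ThreeConnectedOn M S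
  connected⇒ThreeConnectedOn connected rank-one-side X Y = no-1-separation , no-2-separation
    where
    no-1-separation : ¬ IsSeparationOn M S 1 X Y
    no-1-separation sep with separation-lifts sep
    ... | A , B , sepM , _ = connected A B sepM
    no-small-side : ∀ {Z A} → Z ⊆ S → 2 ≤ ∣ Z ∣ → rk M A ≡ 1 → ¬ Z ⊆ A
    no-small-side Z⊆S 2≤∣Z∣ rkA≡1 Z⊆A = contradiction
      (≤-trans 2≤∣Z∣ (simple-rk≤1⇒∣∣≤1 M loopless (proj₁ (proj₂ simp)) Z⊆S
                        (≤-trans (rk-mono M Z⊆A) (≤-reflexive rkA≡1))))
      (λ { (s≤s ()) })
    no-2-separation : ¬ IsSeparationOn M S 2 X Y
    no-2-separation sep@(X∪Y≡S , _ , 2≤∣X∣ , 2≤∣Y∣ , _) with separation-lifts sep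
    ... | A , B , sepM , X⊆A , Y⊆B with rank-one-side A B sepM
    ...   | inj₁ rkA≡1 = no-small-side (subst (X ⊆_) X∪Y≡S (p⊆p∪q Y)) 2≤∣X∣ rkA≡1 X⊆A
    ...   | inj₂ rkB≡1 = no-small-side (subst (Y ⊆_) X∪Y≡S (q⊆p∪q X Y)) 2≤∣Y∣ rkB≡1 Y⊆B

lemma28 : (M : Matroid) → Loopless M →
    AlmostThreeConnected M ⇔
      (Connected M × (∀ A B → IsSeparation M 2 A B → rk M A ≡ 1 ⊎ rk M B ≡ 1))
lemma28 M loopless = mk⇔
  (λ (S , simp , 3conn) → ThreeConnectedOn⇒connected M loopless simp 3conn
                        , ThreeConnectedOn⇒rank-one-side M loopless simp 3conn)
  (λ (connected , rank-one-side) →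
     earliest M , simp₀ , connected⇒ThreeConnectedOn M loopless simp₀ connected rank-one-side)
  where
  simp₀ : IsSimplification M (earliest M)
  simp₀ = earliest-isSimplification M loopless
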